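{- Let $k,l$ be positive integers, $f$ a $k$-variable Boolean function and $g$ an $l$-variable balanced Boolean function. For $0\le i\le k$ let $a_i=\max_{\{\mathbf{w}\in\mathbb{F}_2^k:\mathrm{wt}(\mathbf{w})=i\}}W_f^2(\mathbf{w})$. Then $$H_\infty(f\diamond g)=\min_{i\in\{0,\ldots,k\},\ a_i>0}\big(-\log(a_i)+i\cdot H_\infty(g)\big).$$
   Context: Logarithms are base $2$. $\mathrm{wt}(\mathbf{w})$ is the Hamming weight. For an $m$-variable Boolean function $f:\mathbb{F}_2^m\to\mathbb{F}_2$, the Walsh transform is $W_f(\boldsymbol{\alpha})=2^{ -m}\sum_{\mathbf{x}\in\mathbb{F}_2^m}(-1)^{f(\mathbf{x})\oplus\langle\mathbf{x},\boldsymbol{\alpha}\rangle}$, where $\langle\mathbf{x},\boldsymbol{\alpha}\rangle=\bigoplus_j x_j\alpha_j$; $f$ is balanced if $|\{\mathbf{x}:f(\mathbf{x})=1\}|=2^{m-1}$. The Fourier min-entropy is $H_\infty(f)=\min_{\boldsymbol{\alpha}:W_f^2(\boldsymbol{\alpha})\neq0}\log\frac{1}{W_f^2(\boldsymbol{\alpha})}$. The disjoint composition $f\diamond g$ of a $k$-variable $f$ and an $l$-variable $g$ is the $kl$-variable function $(f\diamond g)(\mathbf{X})=f(g(\mathbf{X}^{(1)}),\ldots,g(\mathbf{X}^{(k)}))$, where $\mathbf{X}^{(i)}=(X_{(i-1)l+1},\ldots,X_{il})$. -}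

module Defs where

open import Data.Bool using (Bool; true; false; _xor_; _∧_; if_then_else_)
open import Data.Nat using (ℕ; zero; suc; _+_; _*_; _∸_; _^_)
open import Data.Nat.Properties using (m^n≢0)
open import Data.Integer as ℤ using (ℤ; +_; -[1+_])
open import Data.Rational as ℚ using (ℚ; 0ℚ; 1ℚ; _/_; _⊔_; _<_)
import Data.List
open import Data.List using (List; []; _∷_; map; concatMap; filter; foldr; length; upTo)
open import Data.Vec using (Vec; []; _∷_; take; drop)
open import Relation.Nullary using (¬_)
open import Relation.Nullary.Decidable using (¬?)
open import Relation.Binary.PropositionalEquality using (_≡_)

BF : ℕ → Set
BF m = Vec Bool m → Bool

allVecs : (m : ℕ) → List (Vec Bool m)
allVecs zero = [] ∷ []
allVecs (suc m) = concatMap (λ v → Data.List._∷_ (false ∷ v) (Data.List._∷_ (true ∷ v) Data.List.[])) (allVecs m)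

wt : ∀ {m} → Vec Bool m → ℕ
wt [] = 0
wt (b ∷ v) = (if b then 1 else 0) + wt v

inner : ∀ {m} → Vec Bool m → Vec Bool m → Bool
inner [] [] = false
inner (x ∷ xs) (a ∷ as) = (x ∧ a) xor inner xs as

balanced : ∀ {m} → BF m → Set
balanced {m} f = length (filter (λ x → f x Data.Bool.≟ true) (allVecs m)) ≡ 2 ^ (m ∸ 1)
  where import Data.Bool

sign : Bool → ℤ
sign false = + 1
sign true = -[1+ 0 ]

sumℤ : List ℤ → ℤ
sumℤ = foldr ℤ._+_ (+ 0)

W : ∀ {m} → BF m → Vec Bool m → ℚ
W {m} f α = _/_ (sumℤ (map (λ x → sign (f x xor inner x α)) (allVecs m))) (2 ^ m) {{m^n≢0 2 m}}

W² : ∀ {m} → BF m → Vec Bool m → ℚ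
W² f α = W f α ℚ.* W f α

-- maximum of a list of rationals (used only on nonempty lists of nonnegative values)
maxℚ : List ℚ → ℚ
maxℚ = foldr _⊔_ 0ℚ

_^ℚ_ : ℚ → ℕ → ℚ
q ^ℚ zero = 1ℚ
q ^ℚ suc n = q ℚ.* (q ^ℚ n)

-- Exact representation of the real numbers -log(q) for rationals q > 0:
-- the value -log q is stored by its argument q (log is injective, so ≡ on
-- arguments is equality of the reals).
record MinusLog : Set where
  constructor -log
  field arg : ℚ
open MinusLog public

_+ₗ_ : MinusLog → MinusLog → MinusLog
-log a +ₗ -log b = -log (a ℚ.* b)

_·ₗ_ : ℕ → MinusLog → MinusLog
i ·ₗ -log a = -log (a ^ℚ i)

-- minimum of a (nonempty) list of values -log q_j, q_j > 0, is -log (max_j q_j)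
minₗ : List MinusLog → MinusLog
minₗ xs = -log (maxℚ (map arg xs))

H∞ : ∀ {m} → BF m → MinusLog
H∞ {m} f = minₗ (map (λ α → -log (W² f α))
                     (filter (λ α → ¬? (W² f α ℚ.≟ 0ℚ)) (allVecs m)))

blocks : ∀ k l {A : Set} → Vec A (k * l) → Vec (Vec A l) k
blocks zero l xs = []
blocks (suc k) l xs = take l xs ∷ blocks k l (drop l xs)

_◇_ : ∀ {k l} → BF k → BF l → BF (k * l)
_◇_ {k} {l} f g X = f (Data.Vec.map g (blocks k l X))

a : ∀ {k} → BF k → ℕ → ℚ
a {k} f i = maxℚ (map (W² f) (filter (λ w → wt w Data.Nat.≟ i) (allVecs k)))
  where import Data.Nat

posIdx : ∀ {k} → BF k → List ℕ
posIdx {k} f = filter (λ i → 0ℚ ℚ.<? a f i) (upTo (suc k))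

{-# OPTIONS --safe #-}
module Submission where

open import Defs
open import Data.Bool as Bool using (Bool; true; false; _xor_; _∧_; _∨_; not; if_then_else_)
import Data.Bool.Properties as Boolₚ
open import Data.Nat as ℕ using (ℕ; zero; suc; NonZero; _^_; z≤n; s≤s)
import Data.Nat.Properties as ℕₚ
open import Data.Integer as ℤ using (ℤ; +_; -[1+_])
import Data.Integer.Properties as ℤₚ
import Data.Integer.Solver as ℤ-Solver
open import Data.Rational as ℚ using (ℚ; 0ℚ; 1ℚ; _/_; _≤_; _⊔_; toℚᵘ; fromℚᵘ)
import Data.Rational.Properties as ℚₚ
import Data.Rational.Solver as ℚ-Solver
open import Data.Rational.Unnormalised as ℚᵘ using (mkℚᵘ; *≡*)
import Data.Rational.Unnormalised.Properties as ℚᵘₚ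
open import Algebra.Bundles using (CommutativeMonoid)
open import Algebra.Properties.CommutativeSemigroup
  (CommutativeMonoid.commutativeSemigroup ℚₚ.*-1-commutativeMonoid)
  using () renaming (interchange to *-interchange)
open import Data.List as List using (List; []; _∷_; map; filter; length; upTo; concatMap)
import Data.List.Properties as Listₚ
open import Data.List.Membership.Propositional using (_∈_)
open import Data.List.Membership.Propositional.Properties
  using (∈-concatMap⁺; ∈-filter⁺; ∈-filter⁻; ∈-upTo⁺)
open import Data.List.Relation.Unary.Any as Any using (here; there)
open import Data.Vec as Vec using (Vec; []; _∷_; _++_; take; drop; replicate)
import Data.Vec.Properties as Vecₚ
open import Data.Product using (∃-syntax; _×_; _,_)
open import Data.Sum using (_⊎_; inj₁; inj₂)
open import Function using (_∘_)
open import Relation.Nullary using (¬_; yes; no; ¬?)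
open import Relation.Nullary.Decidable using (decidable-stable)
open import Relation.Unary using (Pred; Decidable)
open import Relation.Binary.PropositionalEquality
import Relation.Binary.Reasoning.Setoid as SetoidReasoning

-- Write W f α = 𝔼ₓ χ(f x ⊕ ⟨x,α⟩) with χ(b) = (-1)^b and peel off the first block α¹ of α.
-- By induction the other blocks contribute R · u(g x), where u(b) = W_{f(b,·)}(w′) and R, w′ are
-- the product and the support of the remaining blocks.  Expanding u ∘ g = ½(u₀+u₁) + ½(u₀-u₁)·χ∘g,
-- the character sum over the block leaves ½(u₀+u₁) if α¹ = 0 and ½(u₀-u₁)·W_g(α¹) otherwise,
-- since W_g(0) = 0 for balanced g; and ½(u₀ ± u₁) = W_f(b, w′) with b = [α¹ ≠ 0].  Hence
--   W_{f◇g}(α) = W_f(w) · ∏_{α^(i) ≠ 0} W_g(α^(i)),   w_i = [α^(i) ≠ 0],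
-- so W²_{f◇g}(α) ≤ a_{wt w} · M^{wt w} with M = max W_g², with equality at the vector that puts a
-- maximiser of W_g² into the blocks selected by a maximiser w of a_i.  Both sides of the theorem
-- are -log of a maximum, so the theorem is the equality of these two maxima.

fromℚᵘ-homo-+ : ∀ p q → fromℚᵘ (p ℚᵘ.+ q) ≡ fromℚᵘ p ℚ.+ fromℚᵘ q
fromℚᵘ-homo-+ p q = ℚₚ.toℚᵘ-injective (begin
  toℚᵘ (fromℚᵘ (p ℚᵘ.+ q))
    ≈⟨ ℚₚ.toℚᵘ-fromℚᵘ (p ℚᵘ.+ q) ⟩
  p ℚᵘ.+ q
    ≈⟨ ℚᵘₚ.+-cong (ℚₚ.toℚᵘ-fromℚᵘ p) (ℚₚ.toℚᵘ-fromℚᵘ q) ⟨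
  toℚᵘ (fromℚᵘ p) ℚᵘ.+ toℚᵘ (fromℚᵘ q)
    ≈⟨ ℚₚ.toℚᵘ-homo-+ (fromℚᵘ p) (fromℚᵘ q) ⟨
  toℚᵘ (fromℚᵘ p ℚ.+ fromℚᵘ q) ∎)
  where open SetoidReasoning ℚᵘₚ.≃-setoid

fromℚᵘ-homo-* : ∀ p q → fromℚᵘ (p ℚᵘ.* q) ≡ fromℚᵘ p ℚ.* fromℚᵘ q
fromℚᵘ-homo-* p q = ℚₚ.toℚᵘ-injective (begin
  toℚᵘ (fromℚᵘ (p ℚᵘ.* q))
    ≈⟨ ℚₚ.toℚᵘ-fromℚᵘ (p ℚᵘ.* q) ⟩
  p ℚᵘ.* q
    ≈⟨ ℚᵘₚ.*-cong (ℚₚ.toℚᵘ-fromℚᵘ p) (ℚₚ.toℚᵘ-fromℚᵘ q) ⟨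
  toℚᵘ (fromℚᵘ p) ℚᵘ.* toℚᵘ (fromℚᵘ q)
    ≈⟨ ℚₚ.toℚᵘ-homo-* (fromℚᵘ p) (fromℚᵘ q) ⟨
  toℚᵘ (fromℚᵘ p ℚ.* fromℚᵘ q) ∎)
  where open SetoidReasoning ℚᵘₚ.≃-setoid

/-distribʳ-+ : ∀ i j n .{{_ : NonZero n}} → (i ℤ.+ j) / n ≡ i / n ℚ.+ j / n
/-distribʳ-+ i j (suc d) =
  trans (ℚₚ.fromℚᵘ-cong {mkℚᵘ (i ℤ.+ j) d} {mkℚᵘ i d ℚᵘ.+ mkℚᵘ j d} (*≡* cross-multiplied))
        (fromℚᵘ-homo-+ (mkℚᵘ i d) (mkℚᵘ j d))
  where
  open ℤ-Solver.+-*-Solver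
  cross-multiplied : (i ℤ.+ j) ℤ.* + (suc d ℕ.* suc d) ≡ (i ℤ.* + suc d ℤ.+ j ℤ.* + suc d) ℤ.* + suc d
  cross-multiplied = trans (cong ((i ℤ.+ j) ℤ.*_) (ℤₚ.pos-* (suc d) (suc d)))
    (solve 3 (λ i j s → (i :+ j) :* (s :* s) := (i :* s :+ j :* s) :* s) refl i j (+ suc d))

/-distrib-* : ∀ i j m n .{{_ : NonZero m}} .{{_ : NonZero n}} →
              _/_ (i ℤ.* j) (m ℕ.* n) {{ℕₚ.m*n≢0 m n}} ≡ (i / m) ℚ.* (j / n)
/-distrib-* i j (suc a) (suc b) = fromℚᵘ-homo-* (mkℚᵘ i a) (mkℚᵘ j b)

½ : ℚ
½ = + 1 / 2

½*[p+p]≡p : ∀ p → ½ ℚ.* (p ℚ.+ p) ≡ p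
½*[p+p]≡p = solve 1 (λ p → con ½ :* (p :+ p) := p) refl
  where open ℚ-Solver.+-*-Solver

1/2^n≡½^n : ∀ n → _/_ (+ 1) (2 ^ n) {{ℕₚ.m^n≢0 2 n}} ≡ ½ ^ℚ n
1/2^n≡½^n zero    = refl
1/2^n≡½^n (suc n) =
  trans (/-distrib-* (+ 1) (+ 1) 2 (2 ^ n) {{_}} {{ℕₚ.m^n≢0 2 n}}) (cong (½ ℚ.*_) (1/2^n≡½^n n))

sumℚ : List ℚ → ℚ
sumℚ = List.foldr ℚ._+_ 0ℚ

/-distrib-sumℤ : ∀ xs n .{{_ : NonZero n}} → sumℤ xs / n ≡ sumℚ (map (_/ n) xs)
/-distrib-sumℤ []       (suc d) = ℚₚ.0/n≡0 (suc d)
/-distrib-sumℤ (x ∷ xs) n       =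
  trans (/-distribʳ-+ x (sumℤ xs) n) (cong (x / n ℚ.+_) (/-distrib-sumℤ xs n))

-- Expectation over the Boolean cube

𝔼 : ∀ m → (Vec Bool m → ℚ) → ℚ
𝔼 zero    h = h []
𝔼 (suc m) h = 𝔼 m (λ v → ½ ℚ.* (h (false ∷ v) ℚ.+ h (true ∷ v)))

𝔼-cong : ∀ m {h h′ : Vec Bool m → ℚ} → (∀ x → h x ≡ h′ x) → 𝔼 m h ≡ 𝔼 m h′
𝔼-cong zero    h≗h′ = h≗h′ []
𝔼-cong (suc m) h≗h′ =
  𝔼-cong m (λ v → cong (½ ℚ.*_) (cong₂ ℚ._+_ (h≗h′ (false ∷ v)) (h≗h′ (true ∷ v))))

𝔼-distrib-+ : ∀ m (h h′ : Vec Bool m → ℚ) → 𝔼 m (λ x → h x ℚ.+ h′ x) ≡ 𝔼 m h ℚ.+ 𝔼 m h′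
𝔼-distrib-+ zero    h h′ = refl
𝔼-distrib-+ (suc m) h h′ =
  trans (𝔼-cong m (λ v → regroup (h (false ∷ v)) (h′ (false ∷ v)) (h (true ∷ v)) (h′ (true ∷ v))))
        (𝔼-distrib-+ m _ _)
  where
  open ℚ-Solver.+-*-Solver
  regroup : ∀ a a′ b b′ → ½ ℚ.* ((a ℚ.+ a′) ℚ.+ (b ℚ.+ b′))
                        ≡ ½ ℚ.* (a ℚ.+ b) ℚ.+ ½ ℚ.* (a′ ℚ.+ b′)
  regroup = solve 4 (λ a a′ b b′ → con ½ :* ((a :+ a′) :+ (b :+ b′))
                                 := con ½ :* (a :+ b) :+ con ½ :* (a′ :+ b′)) refl

𝔼-*ˡ : ∀ m c (h : Vec Bool m → ℚ) → 𝔼 m (λ x → c ℚ.* h x) ≡ c ℚ.* 𝔼 m h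
𝔼-*ˡ zero    c h = refl
𝔼-*ˡ (suc m) c h = trans (𝔼-cong m (λ v → commute (h (false ∷ v)) (h (true ∷ v)))) (𝔼-*ˡ m c _)
  where
  open ℚ-Solver.+-*-Solver
  commute : ∀ a b → ½ ℚ.* (c ℚ.* a ℚ.+ c ℚ.* b) ≡ c ℚ.* (½ ℚ.* (a ℚ.+ b))
  commute = solve 3 (λ c a b → con ½ :* (c :* a :+ c :* b) := c :* (con ½ :* (a :+ b))) refl c

𝔼-const : ∀ m c → 𝔼 m (λ _ → c) ≡ c
𝔼-const zero    c = refl
𝔼-const (suc m) c = trans (𝔼-cong m (λ _ → ½*[p+p]≡p c)) (𝔼-const m c)

𝔼-++ : ∀ m n (h : Vec Bool (m ℕ.+ n) → ℚ) → 𝔼 (m ℕ.+ n) h ≡ 𝔼 m (λ x → 𝔼 n (λ y → h (x ++ y)))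
𝔼-++ zero    n h = refl
𝔼-++ (suc m) n h = trans (𝔼-++ m n _) (𝔼-cong m (λ x → sym (average-inside x)))
  where
  average-inside : ∀ x → ½ ℚ.* (𝔼 n (λ y → h (false ∷ x ++ y)) ℚ.+ 𝔼 n (λ y → h (true ∷ x ++ y)))
                       ≡ 𝔼 n (λ y → ½ ℚ.* (h (false ∷ x ++ y) ℚ.+ h (true ∷ x ++ y)))
  average-inside x = trans (cong (½ ℚ.*_) (sym (𝔼-distrib-+ n _ _))) (sym (𝔼-*ˡ n ½ _))

sumℚ-allVecs-suc : ∀ m (h : Vec Bool (suc m) → ℚ) →
                   sumℚ (map h (allVecs (suc m)))
                   ≡ sumℚ (map (λ v → h (false ∷ v) ℚ.+ h (true ∷ v)) (allVecs m))
sumℚ-allVecs-suc m h = pairs (allVecs m)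
  where
  pairs : ∀ vs → sumℚ (map h (concatMap (λ v → (false ∷ v) ∷ (true ∷ v) ∷ []) vs))
               ≡ sumℚ (map (λ v → h (false ∷ v) ℚ.+ h (true ∷ v)) vs)
  pairs []       = refl
  pairs (v ∷ vs) = trans (sym (ℚₚ.+-assoc (h (false ∷ v)) (h (true ∷ v)) _))
                         (cong (h (false ∷ v) ℚ.+ h (true ∷ v) ℚ.+_) (pairs vs))

𝔼-allVecs : ∀ m (h : Vec Bool m → ℚ) → sumℚ (map (λ x → ½ ^ℚ m ℚ.* h x) (allVecs m)) ≡ 𝔼 m h
𝔼-allVecs zero    h = trans (ℚₚ.+-identityʳ _) (ℚₚ.*-identityˡ (h []))
𝔼-allVecs (suc m) h = begin
  sumℚ (map (λ x → ½ ^ℚ suc m ℚ.* h x) (allVecs (suc m)))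
    ≡⟨ sumℚ-allVecs-suc m _ ⟩
  sumℚ (map (λ v → ½ ^ℚ suc m ℚ.* h (false ∷ v) ℚ.+ ½ ^ℚ suc m ℚ.* h (true ∷ v)) (allVecs m))
    ≡⟨ cong sumℚ (Listₚ.map-cong (λ v → factor (h (false ∷ v)) (h (true ∷ v))) (allVecs m)) ⟩
  sumℚ (map (λ v → ½ ^ℚ m ℚ.* (½ ℚ.* (h (false ∷ v) ℚ.+ h (true ∷ v)))) (allVecs m))
    ≡⟨ 𝔼-allVecs m _ ⟩
  𝔼 (suc m) h ∎
  where
  open ≡-Reasoning
  open ℚ-Solver.+-*-Solver
  factor : ∀ a b → ½ ^ℚ suc m ℚ.* a ℚ.+ ½ ^ℚ suc m ℚ.* b ≡ ½ ^ℚ m ℚ.* (½ ℚ.* (a ℚ.+ b))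
  factor = solve 3 (λ p a b → (con ½ :* p) :* a :+ (con ½ :* p) :* b := p :* (con ½ :* (a :+ b)))
                   refl (½ ^ℚ m)

-- Characters and Walsh coefficients

χ : Bool → ℚ
χ false = 1ℚ
χ true  = ℚ.- 1ℚ

χ-xor : ∀ a b → χ (a xor b) ≡ χ a ℚ.* χ b
χ-xor false false = refl
χ-xor false true  = refl
χ-xor true  false = refl
χ-xor true  true  = refl

χ-xor-xor : ∀ a b c → χ (a xor (b xor c)) ≡ χ b ℚ.* χ (a xor c)
χ-xor-xor a b c = trans (cong χ swap) (χ-xor b (a xor c))
  where
  swap : a xor (b xor c) ≡ b xor (a xor c)
  swap = trans (sym (Boolₚ.xor-assoc a b c))
               (trans (cong (_xor c) (Boolₚ.xor-comm a b)) (Boolₚ.xor-assoc b a c))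

sign/2^n : ∀ b n → _/_ (sign b) (2 ^ n) {{ℕₚ.m^n≢0 2 n}} ≡ ½ ^ℚ n ℚ.* χ b
sign/2^n false n = trans (1/2^n≡½^n n) (sym (ℚₚ.*-identityʳ (½ ^ℚ n)))
sign/2^n true  n = begin
  ℚ.- (+ 1 / 2 ^ n) {{ℕₚ.m^n≢0 2 n}}  ≡⟨ cong ℚ.-_ (1/2^n≡½^n n) ⟩
  ℚ.- (½ ^ℚ n)                        ≡⟨ cong ℚ.-_ (sym (ℚₚ.*-identityʳ (½ ^ℚ n))) ⟩
  ℚ.- (½ ^ℚ n ℚ.* 1ℚ)                 ≡⟨ ℚₚ.neg-distribʳ-* (½ ^ℚ n) 1ℚ ⟩
  ½ ^ℚ n ℚ.* χ true                   ∎
  where open ≡-Reasoning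

W≡𝔼 : ∀ {m} (f : BF m) α → W f α ≡ 𝔼 m (λ x → χ (f x xor inner x α))
W≡𝔼 {m} f α = begin
  W f α
    ≡⟨ /-distrib-sumℤ (map s (allVecs m)) (2 ^ m) {{ℕₚ.m^n≢0 2 m}} ⟩
  sumℚ (map (λ i → (i / 2 ^ m) {{ℕₚ.m^n≢0 2 m}}) (map s (allVecs m)))
    ≡⟨ cong sumℚ (sym (Listₚ.map-∘ (allVecs m))) ⟩
  sumℚ (map (λ x → (s x / 2 ^ m) {{ℕₚ.m^n≢0 2 m}}) (allVecs m))
    ≡⟨ cong sumℚ (Listₚ.map-cong (λ x → sign/2^n (f x xor inner x α) m) (allVecs m)) ⟩
  sumℚ (map (λ x → ½ ^ℚ m ℚ.* χ (f x xor inner x α)) (allVecs m))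
    ≡⟨ 𝔼-allVecs m _ ⟩
  𝔼 m (λ x → χ (f x xor inner x α)) ∎
  where
  open ≡-Reasoning
  s : Vec Bool m → ℤ
  s x = sign (f x xor inner x α)

nonzero : ∀ {m} → Vec Bool m → Bool
nonzero []      = false
nonzero (b ∷ v) = b ∨ nonzero v

nonzero-replicate : ∀ m → nonzero (replicate m false) ≡ false
nonzero-replicate zero    = refl
nonzero-replicate (suc m) = nonzero-replicate m

nonzero≡false⇒≡0 : ∀ {m} (β : Vec Bool m) → nonzero β ≡ false → β ≡ replicate m false
nonzero≡false⇒≡0 []          _  = refl
nonzero≡false⇒≡0 (false ∷ β) eq = cong (false ∷_) (nonzero≡false⇒≡0 β eq)

𝔼-χ-inner : ∀ {m} (β : Vec Bool m) → 𝔼 m (λ x → χ (inner x β)) ≡ (if nonzero β then 0ℚ else 1ℚ)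
𝔼-χ-inner []                  = refl
𝔼-χ-inner {suc m} (false ∷ β) = trans (𝔼-cong m (λ x → ½*[p+p]≡p (χ (inner x β)))) (𝔼-χ-inner β)
𝔼-χ-inner {suc m} (true ∷ β)  = trans (𝔼-cong m (λ x → cancel (inner x β))) (𝔼-const m 0ℚ)
  where
  cancel : ∀ b → ½ ℚ.* (χ b ℚ.+ χ (not b)) ≡ 0ℚ
  cancel false = refl
  cancel true  = refl

cofactor : ∀ {k} → BF (suc k) → Bool → BF k
cofactor f b v = f (b ∷ v)

W-∷ : ∀ {k} (f : BF (suc k)) b w →
      W f (b ∷ w) ≡ ½ ℚ.* (W (cofactor f false) w ℚ.+ χ b ℚ.* W (cofactor f true) w)
W-∷ {k} f b w = begin
  W f (b ∷ w)
    ≡⟨ W≡𝔼 f (b ∷ w) ⟩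
  𝔼 k (λ v → ½ ℚ.* (c₀ v ℚ.+ χ (f (true ∷ v) xor (b xor inner v w))))
    ≡⟨ 𝔼-cong k (λ v → cong (λ t → ½ ℚ.* (c₀ v ℚ.+ t)) (χ-xor-xor (f (true ∷ v)) b (inner v w))) ⟩
  𝔼 k (λ v → ½ ℚ.* (c₀ v ℚ.+ χ b ℚ.* c₁ v))
    ≡⟨ 𝔼-*ˡ k ½ (λ v → c₀ v ℚ.+ χ b ℚ.* c₁ v) ⟩
  ½ ℚ.* 𝔼 k (λ v → c₀ v ℚ.+ χ b ℚ.* c₁ v)
    ≡⟨ cong (½ ℚ.*_) (trans (𝔼-distrib-+ k c₀ (λ v → χ b ℚ.* c₁ v))
                            (cong (𝔼 k c₀ ℚ.+_) (𝔼-*ˡ k (χ b) c₁))) ⟩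
  ½ ℚ.* (𝔼 k c₀ ℚ.+ χ b ℚ.* 𝔼 k c₁)
    ≡⟨ cong (½ ℚ.*_) (cong₂ (λ s t → s ℚ.+ χ b ℚ.* t) (W≡𝔼 (cofactor f false) w)
                                                    (W≡𝔼 (cofactor f true) w)) ⟨
  ½ ℚ.* (W (cofactor f false) w ℚ.+ χ b ℚ.* W (cofactor f true) w) ∎
  where
  open ≡-Reasoning
  c₀ c₁ : Vec Bool k → ℚ
  c₀ v = χ (f (false ∷ v) xor inner v w)
  c₁ v = χ (f (true ∷ v) xor inner v w)

sumℤ-sign : ∀ {A : Set} (h : A → Bool) xs →
            sumℤ (map (sign ∘ h) xs)
            ≡ + length xs ℤ.- + 2 ℤ.* + length (filter (λ x → h x Bool.≟ true) xs)
sumℤ-sign h []       = refl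
sumℤ-sign h (x ∷ xs) with h x
... | false = trans (cong (ℤ._+_ (+ 1)) (sumℤ-sign h xs))
                    (solve 2 (λ n c → con (+ 1) :+ (n :- con (+ 2) :* c)
                                    := (con (+ 1) :+ n) :- con (+ 2) :* c) refl
                           (+ length xs) (+ length (filter (λ x → h x Bool.≟ true) xs)))
  where open ℤ-Solver.+-*-Solver
... | true  = trans (cong (ℤ._+_ -[1+ 0 ]) (sumℤ-sign h xs))
                    (solve 2 (λ n c → con -[1+ 0 ] :+ (n :- con (+ 2) :* c)
                                    := (con (+ 1) :+ n) :- con (+ 2) :* (con (+ 1) :+ c)) refl
                           (+ length xs) (+ length (filter (λ x → h x Bool.≟ true) xs)))
  where open ℤ-Solver.+-*-Solver

length-allVecs : ∀ m → length (allVecs m) ≡ 2 ^ m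
length-allVecs zero    = refl
length-allVecs (suc m) = trans (doubles (allVecs m)) (cong (2 ℕ.*_) (length-allVecs m))
  where
  doubles : ∀ (vs : List (Vec Bool m)) →
            length (concatMap (λ v → (false ∷ v) ∷ (true ∷ v) ∷ []) vs) ≡ 2 ℕ.* length vs
  doubles []       = refl
  doubles (v ∷ vs) = trans (cong (2 ℕ.+_) (doubles vs)) (sym (ℕₚ.*-distribˡ-+ 2 1 (length vs)))

balanced⇒sum-sign≡0 : ∀ {l} (g : BF (suc l)) → balanced g → sumℤ (map (sign ∘ g) (allVecs (suc l))) ≡ + 0
balanced⇒sum-sign≡0 {l} g bal = begin
  sumℤ (map (sign ∘ g) (allVecs (suc l)))
    ≡⟨ sumℤ-sign g (allVecs (suc l)) ⟩
  + length (allVecs (suc l)) ℤ.- + 2 ℤ.* + length (filter (λ x → g x Bool.≟ true) (allVecs (suc l)))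
    ≡⟨ cong₂ (λ n c → + n ℤ.- + 2 ℤ.* + c) (length-allVecs (suc l)) bal ⟩
  + (2 ℕ.* 2 ^ l) ℤ.- + 2 ℤ.* + 2 ^ l
    ≡⟨ cong (ℤ._- + 2 ℤ.* + 2 ^ l) (ℤₚ.pos-* 2 (2 ^ l)) ⟩
  + 2 ℤ.* + 2 ^ l ℤ.- + 2 ℤ.* + 2 ^ l
    ≡⟨ ℤₚ.+-inverseʳ (+ 2 ℤ.* + 2 ^ l) ⟩
  + 0 ∎
  where open ≡-Reasoning

inner-zeroʳ : ∀ {m} (x : Vec Bool m) → inner x (replicate m false) ≡ false
inner-zeroʳ []      = refl
inner-zeroʳ (b ∷ x) rewrite Boolₚ.∧-zeroʳ b = inner-zeroʳ x

balanced⇒W-zero : ∀ {l} (g : BF (suc l)) → balanced g → W g (replicate (suc l) false) ≡ 0ℚ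
balanced⇒W-zero {l} g bal = begin
  W g 0v
    ≡⟨ cong (scaled ∘ sumℤ) (Listₚ.map-cong at-zero (allVecs (suc l))) ⟩
  scaled (sumℤ (map (sign ∘ g) (allVecs (suc l))))
    ≡⟨ cong scaled (balanced⇒sum-sign≡0 g bal) ⟩
  scaled (+ 0)
    ≡⟨ ℚₚ.0/n≡0 (2 ^ suc l) {{ℕₚ.m^n≢0 2 (suc l)}} ⟩
  0ℚ ∎
  where
  open ≡-Reasoning
  0v = replicate (suc l) false
  scaled : ℤ → ℚ
  scaled i = (i / 2 ^ suc l) {{ℕₚ.m^n≢0 2 (suc l)}}
  at-zero : ∀ x → sign (g x xor inner x 0v) ≡ sign (g x)
  at-zero x = cong sign (trans (cong (g x xor_) (inner-zeroʳ x)) (Boolₚ.xor-identityʳ (g x)))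

-- The Walsh spectrum of a disjoint composition

take-++ : ∀ {A : Set} m {n} (x : Vec A m) (y : Vec A n) → take m (x ++ y) ≡ x
take-++ m x y = Vecₚ.++-injectiveˡ (take m (x ++ y)) x (Vecₚ.take++drop≡id m (x ++ y))

drop-++ : ∀ {A : Set} m {n} (x : Vec A m) (y : Vec A n) → drop m (x ++ y) ≡ y
drop-++ m x y = Vecₚ.++-injectiveʳ (take m (x ++ y)) x (Vecₚ.take++drop≡id m (x ++ y))

blocks-++ : ∀ {A : Set} k l (x : Vec A l) (y : Vec A (k ℕ.* l)) → blocks (suc k) l (x ++ y) ≡ x ∷ blocks k l y
blocks-++ k l x y = cong₂ (λ x′ y′ → x′ ∷ blocks k l y′) (take-++ l x y) (drop-++ l x y)

inner-++ : ∀ {m n} (x : Vec Bool m) (y : Vec Bool n) α →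
           inner (x ++ y) α ≡ inner x (take m α) xor inner y (drop m α)
inner-++ []      y α       = refl
inner-++ (b ∷ x) y (a ∷ α) =
  trans (cong ((b ∧ a) xor_) (inner-++ x y α)) (sym (Boolₚ.xor-assoc (b ∧ a) _ _))

W-◇-suc : ∀ {k l} (f : BF (suc k)) (g : BF l) α →
          W (f ◇ g) α ≡ 𝔼 l (λ x → χ (inner x (take l α)) ℚ.* W (cofactor f (g x) ◇ g) (drop l α))
W-◇-suc {k} {l} f g α = begin
  W (f ◇ g) α
    ≡⟨ W≡𝔼 (f ◇ g) α ⟩
  𝔼 (l ℕ.+ k ℕ.* l) (λ z → χ ((f ◇ g) z xor inner z α))
    ≡⟨ 𝔼-++ l (k ℕ.* l) _ ⟩
  𝔼 l (λ x → 𝔼 (k ℕ.* l) (λ y → χ ((f ◇ g) (x ++ y) xor inner (x ++ y) α)))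
    ≡⟨ 𝔼-cong l (λ x → trans (𝔼-cong (k ℕ.* l) (split x)) (𝔼-*ˡ (k ℕ.* l) (χ (inner x α₁)) _)) ⟩
  𝔼 l (λ x → χ (inner x α₁) ℚ.* 𝔼 (k ℕ.* l) (λ y → χ ((cofactor f (g x) ◇ g) y xor inner y αᵣ)))
    ≡⟨ 𝔼-cong l (λ x → cong (χ (inner x α₁) ℚ.*_) (W≡𝔼 (cofactor f (g x) ◇ g) αᵣ)) ⟨
  𝔼 l (λ x → χ (inner x α₁) ℚ.* W (cofactor f (g x) ◇ g) αᵣ) ∎
  where
  open ≡-Reasoning
  α₁ = take l α
  αᵣ = drop l α
  split : ∀ x y → χ ((f ◇ g) (x ++ y) xor inner (x ++ y) α)
                ≡ χ (inner x α₁) ℚ.* χ ((cofactor f (g x) ◇ g) y xor inner y αᵣ)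
  split x y = trans (cong₂ (λ s t → χ (s xor t)) (cong (f ∘ Vec.map g) (blocks-++ k l x y)) (inner-++ x y α))
                    (χ-xor-xor ((cofactor f (g x) ◇ g) y) (inner x α₁) (inner y αᵣ))

support : ∀ k l → Vec Bool (k ℕ.* l) → Vec Bool k
support k l α = Vec.map nonzero (blocks k l α)

module _ {l : ℕ} (g : BF l) where

  blockWeight : Vec Bool l → ℚ
  blockWeight β = if nonzero β then W g β else 1ℚ

  blockProduct : ∀ k → Vec Bool (k ℕ.* l) → ℚ
  blockProduct k α = Vec.foldr′ ℚ._*_ 1ℚ (Vec.map blockWeight (blocks k l α))

𝔼-χ-inner-*-∘ : ∀ {l} (g : BF l) (u : Bool → ℚ) β →
                𝔼 l (λ x → χ (inner x β) ℚ.* u (g x))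
                ≡ ½ ℚ.* (u false ℚ.+ u true) ℚ.* (if nonzero β then 0ℚ else 1ℚ)
                  ℚ.+ ½ ℚ.* (u false ℚ.- u true) ℚ.* W g β
𝔼-χ-inner-*-∘ {l} g u β = begin
  𝔼 l (λ x → χ (inner x β) ℚ.* u (g x))
    ≡⟨ 𝔼-cong l (λ x → trans (affine (g x) (χ (inner x β)))
                             (cong (λ t → p ℚ.* χ (inner x β) ℚ.+ q ℚ.* t) (sym (χ-xor (g x) (inner x β))))) ⟩
  𝔼 l (λ x → p ℚ.* χ (inner x β) ℚ.+ q ℚ.* χ (g x xor inner x β))
    ≡⟨ 𝔼-distrib-+ l (λ x → p ℚ.* χ (inner x β)) (λ x → q ℚ.* χ (g x xor inner x β)) ⟩
  𝔼 l (λ x → p ℚ.* χ (inner x β)) ℚ.+ 𝔼 l (λ x → q ℚ.* χ (g x xor inner x β))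
    ≡⟨ cong₂ ℚ._+_ (𝔼-*ˡ l p _) (𝔼-*ˡ l q _) ⟩
  p ℚ.* 𝔼 l (λ x → χ (inner x β)) ℚ.+ q ℚ.* 𝔼 l (λ x → χ (g x xor inner x β))
    ≡⟨ cong₂ (λ s t → p ℚ.* s ℚ.+ q ℚ.* t) (𝔼-χ-inner β) (sym (W≡𝔼 g β)) ⟩
  p ℚ.* (if nonzero β then 0ℚ else 1ℚ) ℚ.+ q ℚ.* W g β ∎
  where
  open ≡-Reasoning
  open ℚ-Solver.+-*-Solver
  p q : ℚ
  p = ½ ℚ.* (u false ℚ.+ u true)
  q = ½ ℚ.* (u false ℚ.- u true)
  affine : ∀ b c → c ℚ.* u b ≡ p ℚ.* c ℚ.+ q ℚ.* (χ b ℚ.* c)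
  affine false c = solve 3 (λ c u₀ u₁ → c :* u₀
                                      := con ½ :* (u₀ :+ u₁) :* c :+ con ½ :* (u₀ :- u₁) :* (con 1ℚ :* c))
                           refl c (u false) (u true)
  affine true  c = solve 3 (λ c u₀ u₁ → c :* u₁
                                      := con ½ :* (u₀ :+ u₁) :* c :+ con ½ :* (u₀ :- u₁) :* (:- con 1ℚ :* c))
                           refl c (u false) (u true)

𝔼-χ-inner-*-∘-unbiased : ∀ {l} (g : BF l) → W g (replicate l false) ≡ 0ℚ → ∀ (u : Bool → ℚ) β →
                         𝔼 l (λ x → χ (inner x β) ℚ.* u (g x))
                         ≡ blockWeight g β ℚ.* (½ ℚ.* (u false ℚ.+ χ (nonzero β) ℚ.* u true))
𝔼-χ-inner-*-∘-unbiased {l} g g₀ u β = trans (𝔼-χ-inner-*-∘ g u β) (by-block (nonzero β) refl)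
  where
  open ℚ-Solver.+-*-Solver
  by-block : ∀ z → nonzero β ≡ z →
             ½ ℚ.* (u false ℚ.+ u true) ℚ.* (if z then 0ℚ else 1ℚ)
               ℚ.+ ½ ℚ.* (u false ℚ.- u true) ℚ.* W g β
             ≡ (if z then W g β else 1ℚ) ℚ.* (½ ℚ.* (u false ℚ.+ χ z ℚ.* u true))
  by-block true  _  =
    solve 3 (λ u₀ u₁ w → con ½ :* (u₀ :+ u₁) :* con 0ℚ :+ con ½ :* (u₀ :- u₁) :* w
                       := w :* (con ½ :* (u₀ :+ :- con 1ℚ :* u₁)))
          refl (u false) (u true) (W g β)
  by-block false eq rewrite nonzero≡false⇒≡0 β eq | g₀ =
    solve 2 (λ u₀ u₁ → con ½ :* (u₀ :+ u₁) :* con 1ℚ :+ con ½ :* (u₀ :- u₁) :* con 0ℚ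
                     := con 1ℚ :* (con ½ :* (u₀ :+ con 1ℚ :* u₁)))
          refl (u false) (u true)

W-◇ : ∀ {l} (g : BF l) → W g (replicate l false) ≡ 0ℚ →
      ∀ k (f : BF k) α → W (f ◇ g) α ≡ W f (support k l α) ℚ.* blockProduct g k α
W-◇     g g₀ zero    f [] = sym (ℚₚ.*-identityʳ (W f []))
W-◇ {l} g g₀ (suc k) f α  = begin
  W (f ◇ g) α
    ≡⟨ W-◇-suc f g α ⟩
  𝔼 l (λ x → χ (inner x α₁) ℚ.* W (cofactor f (g x) ◇ g) αᵣ)
    ≡⟨ 𝔼-cong l (λ x → trans (cong (χ (inner x α₁) ℚ.*_) (W-◇ g g₀ k (cofactor f (g x)) αᵣ))
                             (pull-out (χ (inner x α₁)) (u (g x)) R)) ⟩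
  𝔼 l (λ x → R ℚ.* (χ (inner x α₁) ℚ.* u (g x)))
    ≡⟨ 𝔼-*ˡ l R _ ⟩
  R ℚ.* 𝔼 l (λ x → χ (inner x α₁) ℚ.* u (g x))
    ≡⟨ cong (R ℚ.*_) (𝔼-χ-inner-*-∘-unbiased g g₀ u α₁) ⟩
  R ℚ.* (blockWeight g α₁ ℚ.* (½ ℚ.* (u false ℚ.+ χ (nonzero α₁) ℚ.* u true)))
    ≡⟨ cong (λ t → R ℚ.* (blockWeight g α₁ ℚ.* t)) (W-∷ f (nonzero α₁) wᵣ) ⟨
  R ℚ.* (blockWeight g α₁ ℚ.* W f (nonzero α₁ ∷ wᵣ))
    ≡⟨ reverse R (blockWeight g α₁) (W f (nonzero α₁ ∷ wᵣ)) ⟩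
  W f (nonzero α₁ ∷ wᵣ) ℚ.* (blockWeight g α₁ ℚ.* R) ∎
  where
  open ≡-Reasoning
  open ℚ-Solver.+-*-Solver
  α₁ = take l α
  αᵣ = drop l α
  wᵣ = support k l αᵣ
  R = blockProduct g k αᵣ
  u : Bool → ℚ
  u b = W (cofactor f b) wᵣ
  pull-out : ∀ a b c → a ℚ.* (b ℚ.* c) ≡ c ℚ.* (a ℚ.* b)
  pull-out = solve 3 (λ a b c → a :* (b :* c) := c :* (a :* b)) refl
  reverse : ∀ a b c → a ℚ.* (b ℚ.* c) ≡ c ℚ.* (b ℚ.* a)
  reverse = solve 3 (λ a b c → a :* (b :* c) := c :* (b :* a)) refl

maxℚ-nonneg : ∀ xs → 0ℚ ≤ maxℚ xs
maxℚ-nonneg []       = ℚₚ.≤-refl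
maxℚ-nonneg (x ∷ xs) = ℚₚ.≤-trans (maxℚ-nonneg xs) (ℚₚ.p≤q⊔p x (maxℚ xs))

module _ {A : Set} (h : A → ℚ) where

  ≤-maxℚ : ∀ {x xs} → x ∈ xs → h x ≤ maxℚ (map h xs)
  ≤-maxℚ {xs = y ∷ ys} (here refl) = ℚₚ.p≤p⊔q (h y) (maxℚ (map h ys))
  ≤-maxℚ {xs = y ∷ ys} (there x∈)  = ℚₚ.≤-trans (≤-maxℚ x∈) (ℚₚ.p≤q⊔p (h y) (maxℚ (map h ys)))

  maxℚ-lub : ∀ {c} xs → 0ℚ ≤ c → (∀ {x} → x ∈ xs → h x ≤ c) → maxℚ (map h xs) ≤ c
  maxℚ-lub []       0≤c _     = 0≤c
  maxℚ-lub (x ∷ xs) 0≤c bound = ℚₚ.⊔-lub (bound (here refl)) (maxℚ-lub xs 0≤c (bound ∘ there))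

  maxℚ-attained : ∀ xs → maxℚ (map h xs) ≡ 0ℚ ⊎ ∃[ x ] (x ∈ xs × h x ≡ maxℚ (map h xs))
  maxℚ-attained []       = inj₁ refl
  maxℚ-attained (x ∷ xs) with ℚₚ.⊔-sel (h x) (maxℚ (map h xs))
  ... | inj₁ left  = inj₂ (x , here refl , sym left)
  ... | inj₂ right with maxℚ-attained xs
  ...   | inj₁ max≡0          = inj₁ (trans right max≡0)
  ...   | inj₂ (y , y∈ , h≡) = inj₂ (y , there y∈ , trans h≡ (sym right))

  maxℚ-filter : ∀ {p} {P : Pred A p} (P? : Decidable P) → (∀ x → ¬ P x → h x ≤ 0ℚ) →
                ∀ xs → maxℚ (map h (filter P? xs)) ≡ maxℚ (map h xs)
  maxℚ-filter P? dropped []       = refl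
  maxℚ-filter P? dropped (x ∷ xs) with P? x
  ... | yes _  = cong (h x ⊔_) (maxℚ-filter P? dropped xs)
  ... | no ¬px = trans (maxℚ-filter P? dropped xs)
                       (sym (ℚₚ.p≤q⇒p⊔q≡q (ℚₚ.≤-trans (dropped x ¬px) (maxℚ-nonneg (map h xs)))))

∈-allVecs : ∀ {m} (v : Vec Bool m) → v ∈ allVecs m
∈-allVecs []      = here refl
∈-allVecs (b ∷ v) =
  ∈-concatMap⁺ (λ u → (false ∷ u) ∷ (true ∷ u) ∷ []) (Any.map (λ { refl → ∈-pair b }) (∈-allVecs v))
  where
  ∈-pair : ∀ b → b ∷ v ∈ (false ∷ v) ∷ (true ∷ v) ∷ []
  ∈-pair false = here refl
  ∈-pair true  = there (here refl)

p*p≥0 : ∀ p → 0ℚ ≤ p ℚ.* p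
p*p≥0 p with ℚₚ.≤-total 0ℚ p
... | inj₁ 0≤p = ℚₚ.nonNegative⁻¹ (p ℚ.* p)
                   {{ℚₚ.nonNeg*nonNeg⇒nonNeg p {{ℚ.nonNegative 0≤p}} p {{ℚ.nonNegative 0≤p}}}}
... | inj₂ p≤0 = ℚₚ.nonNegative⁻¹ (p ℚ.* p)
                   {{ℚₚ.nonPos*nonPos⇒nonPos p {{ℚ.nonPositive p≤0}} p {{ℚ.nonPositive p≤0}}}}

*-mono-≤-nonNeg : ∀ {p q r s} → 0ℚ ≤ q → 0ℚ ≤ r → p ≤ q → r ≤ s → p ℚ.* r ≤ q ℚ.* s
*-mono-≤-nonNeg {q = q} {r = r} 0≤q 0≤r p≤q r≤s =
  ℚₚ.≤-trans (ℚₚ.*-monoʳ-≤-nonNeg r {{ℚ.nonNegative 0≤r}} p≤q)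
             (ℚₚ.*-monoˡ-≤-nonNeg q {{ℚ.nonNegative 0≤q}} r≤s)

^ℚ-distribʳ-* : ∀ n p q → (p ℚ.* q) ^ℚ n ≡ p ^ℚ n ℚ.* q ^ℚ n
^ℚ-distribʳ-* zero    p q = refl
^ℚ-distribʳ-* (suc n) p q =
  trans (cong ((p ℚ.* q) ℚ.*_) (^ℚ-distribʳ-* n p q)) (*-interchange p q (p ^ℚ n) (q ^ℚ n))

-- Maxima of the squared Walsh spectrum

maxW² : ∀ {m} → BF m → ℚ
maxW² {m} f = maxℚ (map (W² f) (allVecs m))

maxW²-nonneg : ∀ {m} (f : BF m) → 0ℚ ≤ maxW² f
maxW²-nonneg {m} f = maxℚ-nonneg (map (W² f) (allVecs m))

a-nonneg : ∀ {k} (f : BF k) i → 0ℚ ≤ a f i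
a-nonneg {k} f i = maxℚ-nonneg (map (W² f) (filter (λ w → wt w ℕ.≟ i) (allVecs k)))

W²≤a : ∀ {k} (f : BF k) w → W² f w ≤ a f (wt w)
W²≤a f w = ≤-maxℚ (W² f) (∈-filter⁺ (λ v → wt v ℕ.≟ wt w) (∈-allVecs w) refl)

wt≤length : ∀ {m} (w : Vec Bool m) → wt w ℕ.≤ m
wt≤length []          = z≤n
wt≤length (false ∷ w) = ℕₚ.m≤n⇒m≤1+n (wt≤length w)
wt≤length (true ∷ w)  = s≤s (wt≤length w)

arg-H∞ : ∀ {m} (f : BF m) → arg (H∞ f) ≡ maxW² f
arg-H∞ {m} f = trans (cong maxℚ (sym (Listₚ.map-∘ (filter nonvanishing? (allVecs m)))))
                     (maxℚ-filter (W² f) nonvanishing? vanishing (allVecs m))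
  where
  nonvanishing? = λ α → ¬? (W² f α ℚ.≟ 0ℚ)
  vanishing : ∀ α → ¬ ¬ (W² f α ≡ 0ℚ) → W² f α ≤ 0ℚ
  vanishing α ¬¬W²≡0 = ℚₚ.≤-reflexive (decidable-stable (W² f α ℚ.≟ 0ℚ) ¬¬W²≡0)

arg-minₗ-posIdx : ∀ {k l} (f : BF k) (g : BF l) →
                  arg (minₗ (map (λ i → (-log (a f i)) +ₗ (i ·ₗ H∞ g)) (posIdx f)))
                  ≡ maxℚ (map (λ i → a f i ℚ.* maxW² g ^ℚ i) (upTo (suc k)))
arg-minₗ-posIdx {k} f g = begin
  maxℚ (map arg (map (λ i → (-log (a f i)) +ₗ (i ·ₗ H∞ g)) (posIdx f)))
    ≡⟨ cong maxℚ (sym (Listₚ.map-∘ (posIdx f))) ⟩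
  maxℚ (map (λ i → a f i ℚ.* arg (H∞ g) ^ℚ i) (posIdx f))
    ≡⟨ maxℚ-filter _ (λ i → 0ℚ ℚ.<? a f i) vanishing (upTo (suc k)) ⟩
  maxℚ (map (λ i → a f i ℚ.* arg (H∞ g) ^ℚ i) (upTo (suc k)))
    ≡⟨ cong (λ M → maxℚ (map (λ i → a f i ℚ.* M ^ℚ i) (upTo (suc k)))) (arg-H∞ g) ⟩
  maxℚ (map (λ i → a f i ℚ.* maxW² g ^ℚ i) (upTo (suc k))) ∎
  where
  open ≡-Reasoning
  vanishing : ∀ i → ¬ (0ℚ ℚ.< a f i) → a f i ℚ.* arg (H∞ g) ^ℚ i ≤ 0ℚ
  vanishing i a≯0 =
    ℚₚ.≤-reflexive (trans (cong (ℚ._* arg (H∞ g) ^ℚ i) a≡0) (ℚₚ.*-zeroˡ (arg (H∞ g) ^ℚ i)))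
    where a≡0 = ℚₚ.≤-antisym (ℚₚ.≮⇒≥ a≯0) (a-nonneg f i)

W²-◇ : ∀ {l} (g : BF l) → W g (replicate l false) ≡ 0ℚ → ∀ k (f : BF k) α →
       W² (f ◇ g) α ≡ W² f (support k l α) ℚ.* (blockProduct g k α ℚ.* blockProduct g k α)
W²-◇ {l} g g₀ k f α = trans (cong (λ t → t ℚ.* t) (W-◇ g g₀ k f α))
                            (*-interchange (W f (support k l α)) (blockProduct g k α) _ _)

blockProduct²≤maxW²^wt : ∀ {l} (g : BF l) k α →
                         blockProduct g k α ℚ.* blockProduct g k α ≤ maxW² g ^ℚ wt (support k l α)
blockProduct²≤maxW²^wt     g zero    []  = ℚₚ.≤-refl
blockProduct²≤maxW²^wt {l} g (suc k) α with nonzero (take l α)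
... | true  = begin
  (W g β ℚ.* R) ℚ.* (W g β ℚ.* R)  ≡⟨ *-interchange (W g β) R (W g β) R ⟩
  W² g β ℚ.* (R ℚ.* R)             ≤⟨ *-mono-≤-nonNeg (maxW²-nonneg g) (p*p≥0 R)
                                                       (≤-maxℚ (W² g) (∈-allVecs β)) IH ⟩
  maxW² g ℚ.* maxW² g ^ℚ wt (support k l (drop l α)) ∎
  where
  open ℚₚ.≤-Reasoning
  β = take l α
  R = blockProduct g k (drop l α)
  IH = blockProduct²≤maxW²^wt g k (drop l α)
... | false = ℚₚ.≤-trans (ℚₚ.≤-reflexive (cong₂ ℚ._*_ (ℚₚ.*-identityˡ R) (ℚₚ.*-identityˡ R)))
                         (blockProduct²≤maxW²^wt g k (drop l α))
  where R = blockProduct g k (drop l α)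

W²-◇-≤ : ∀ {l} (g : BF l) → W g (replicate l false) ≡ 0ℚ → ∀ k (f : BF k) α →
         W² (f ◇ g) α ≤ a f (wt (support k l α)) ℚ.* maxW² g ^ℚ wt (support k l α)
W²-◇-≤ {l} g g₀ k f α = begin
  W² (f ◇ g) α                    ≡⟨ W²-◇ g g₀ k f α ⟩
  W² f w ℚ.* (R ℚ.* R)            ≤⟨ *-mono-≤-nonNeg (a-nonneg f (wt w)) (p*p≥0 R) (W²≤a f w)
                                                       (blockProduct²≤maxW²^wt g k α) ⟩
  a f (wt w) ℚ.* maxW² g ^ℚ wt w  ∎
  where
  open ℚₚ.≤-Reasoning
  w = support k l α
  R = blockProduct g k α

spread : ∀ {k l} → Vec Bool k → Vec Bool l → Vec Bool (k ℕ.* l)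
spread          []      β = []
spread {l = l} (b ∷ w) β = (if b then β else replicate l false) ++ spread w β

support-spread : ∀ {k l} (w : Vec Bool k) {β : Vec Bool l} → nonzero β ≡ true →
                 support k l (spread w β) ≡ w
support-spread                  []      _  = refl
support-spread {suc k} {l} (b ∷ w) {β} nz =
  trans (cong (Vec.map nonzero) (blocks-++ k l _ (spread w β))) (cong₂ _∷_ (leading b) (support-spread w nz))
  where
  leading : ∀ b → nonzero (if b then β else replicate l false) ≡ b
  leading true  = nz
  leading false = nonzero-replicate l

blockProduct-spread : ∀ {k l} (g : BF l) (w : Vec Bool k) {β : Vec Bool l} → nonzero β ≡ true →
                      blockProduct g k (spread w β) ≡ W g β ^ℚ wt w
blockProduct-spread                g []      _  = refl
blockProduct-spread {suc k} {l} g (b ∷ w) {β} nz =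
  trans (cong (Vec.foldr′ ℚ._*_ 1ℚ ∘ Vec.map (blockWeight g)) (blocks-++ k l _ (spread w β))) (leading b)
  where
  IH = blockProduct-spread g w nz
  leading : ∀ b → blockWeight g (if b then β else replicate l false) ℚ.* blockProduct g k (spread w β)
                  ≡ W g β ^ℚ wt (b ∷ w)
  leading true  = cong₂ ℚ._*_ (cong (λ z → if z then W g β else 1ℚ) nz) IH
  leading false = trans (cong (λ z → (if z then W g 0v else 1ℚ) ℚ.* blockProduct g k (spread w β))
                              (nonzero-replicate l))
                        (trans (ℚₚ.*-identityˡ _) IH)
    where 0v = replicate l false

W²-◇-spread : ∀ {l} (g : BF l) → W g (replicate l false) ≡ 0ℚ →
              ∀ {k} (f : BF k) w {β} → nonzero β ≡ true →
              W² (f ◇ g) (spread w β) ≡ W² f w ℚ.* W² g β ^ℚ wt w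
W²-◇-spread {l} g g₀ {k} f w {β} nz = begin
  W² (f ◇ g) (spread w β)
    ≡⟨ W²-◇ g g₀ k f (spread w β) ⟩
  W² f (support k l (spread w β)) ℚ.* (blockProduct g k (spread w β) ℚ.* blockProduct g k (spread w β))
    ≡⟨ cong₂ (λ v p → W² f v ℚ.* (p ℚ.* p)) (support-spread w nz) (blockProduct-spread g w nz) ⟩
  W² f w ℚ.* (W g β ^ℚ wt w ℚ.* W g β ^ℚ wt w)
    ≡⟨ cong (W² f w ℚ.*_) (^ℚ-distribʳ-* (wt w) (W g β) (W g β)) ⟨
  W² f w ℚ.* W² g β ^ℚ wt w ∎
  where open ≡-Reasoning

-- The maximiser found by maxℚ-attained may be β = 0; then maxW² g = 0 and e₁ serves instead.
maxW²-attained-off-zero : ∀ {l} (g : BF (suc l)) → W g (replicate (suc l) false) ≡ 0ℚ →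
                          ∃[ β ] (nonzero β ≡ true × W² g β ≡ maxW² g)
maxW²-attained-off-zero {l} g g₀ = from-attained (maxℚ-attained (W² g) (allVecs (suc l)))
  where
  e₁ = true ∷ replicate l false
  at-e₁ : maxW² g ≡ 0ℚ → ∃[ β ] (nonzero β ≡ true × W² g β ≡ maxW² g)
  at-e₁ max≡0 = e₁ , refl , ℚₚ.≤-antisym (≤-maxℚ (W² g) (∈-allVecs e₁))
                                         (ℚₚ.≤-trans (ℚₚ.≤-reflexive max≡0) (p*p≥0 (W g e₁)))
  from-attained : maxW² g ≡ 0ℚ ⊎ ∃[ β ] (β ∈ allVecs (suc l) × W² g β ≡ maxW² g) →
                  ∃[ β ] (nonzero β ≡ true × W² g β ≡ maxW² g)
  from-attained (inj₁ max≡0)            = at-e₁ max≡0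
  from-attained (inj₂ (β , _ , W²≡max)) with nonzero β in nz
  ... | true  = β , nz , W²≡max
  ... | false = at-e₁ (trans (sym W²≡max) (cong (λ t → t ℚ.* t) W≡0))
    where W≡0 = trans (cong (W g) (nonzero≡false⇒≡0 β nz)) g₀

maxW²-◇ : ∀ {l} (g : BF (suc l)) → W g (replicate (suc l) false) ≡ 0ℚ → ∀ {k} (f : BF k) →
          maxW² (f ◇ g) ≡ maxℚ (map (λ i → a f i ℚ.* maxW² g ^ℚ i) (upTo (suc k)))
maxW²-◇ {l} g g₀ {k} f = ℚₚ.≤-antisym
  (maxℚ-lub (W² (f ◇ g)) (allVecs (k ℕ.* suc l)) (maxℚ-nonneg (map term (upTo (suc k))))
             (λ {α} _ → W²≤max α))
  (maxℚ-lub term (upTo (suc k)) (maxW²-nonneg (f ◇ g)) (λ {i} _ → term≤max i))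
  where
  term : ℕ → ℚ
  term i = a f i ℚ.* maxW² g ^ℚ i
  W²≤max : ∀ α → W² (f ◇ g) α ≤ maxℚ (map term (upTo (suc k)))
  W²≤max α = ℚₚ.≤-trans (W²-◇-≤ g g₀ k f α)
                        (≤-maxℚ term (∈-upTo⁺ (s≤s (wt≤length (support k (suc l) α)))))
  term≤max : ∀ i → term i ≤ maxW² (f ◇ g)
  term≤max i with maxℚ-attained (W² f) (filter (λ w → wt w ℕ.≟ i) (allVecs k))
  ... | inj₁ a≡0 = ℚₚ.≤-trans (ℚₚ.≤-reflexive (trans (cong (ℚ._* maxW² g ^ℚ i) a≡0)
                                                     (ℚₚ.*-zeroˡ (maxW² g ^ℚ i))))
                              (maxW²-nonneg (f ◇ g))
  ... | inj₂ (w , w∈ , W²≡a) with ∈-filter⁻ (λ w → wt w ℕ.≟ i) {xs = allVecs k} w∈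
  ...   | _ , refl with maxW²-attained-off-zero g g₀
  ...     | β , nz , W²≡maxW² =
    ℚₚ.≤-trans (ℚₚ.≤-reflexive realised) (≤-maxℚ (W² (f ◇ g)) (∈-allVecs (spread w β)))
    where
    realised : term (wt w) ≡ W² (f ◇ g) (spread w β)
    realised = trans (cong₂ (λ s t → s ℚ.* t ^ℚ wt w) (sym W²≡a) (sym W²≡maxW²))
                     (sym (W²-◇-spread g g₀ f w nz))

theorem4 : (k l : ℕ) (f : BF (suc k)) (g : BF (suc l)) → balanced g →
    H∞ (f ◇ g) ≡ minₗ (map (λ i → (-log (a f i)) +ₗ (i ·ₗ H∞ g)) (posIdx f))
theorem4 k l f g bal = cong -log (begin
  arg (H∞ (f ◇ g))
    ≡⟨ arg-H∞ (f ◇ g) ⟩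
  maxW² (f ◇ g)
    ≡⟨ maxW²-◇ g (balanced⇒W-zero g bal) f ⟩
  maxℚ (map (λ i → a f i ℚ.* maxW² g ^ℚ i) (upTo (suc (suc k))))
    ≡⟨ arg-minₗ-posIdx f g ⟨
  arg (minₗ (map (λ i → (-log (a f i)) +ₗ (i ·ₗ H∞ g)) (posIdx f))) ∎)
  where open ≡-Reasoning
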